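{- Let $q$ be an odd prime power with $q\equiv 1\pmod 3$, let $m=(q-1)/3$, and let $\gamma$ be a generator of the multiplicative group $\mathbf{F}_q^*$. For an integer $k$ with $0\le k\le m-1$, define elements $a_k,b_k,c_k\in\mathbf{F}_q$ by $$a_k=\frac{\gamma^{2m+6k+2}+\gamma^{m+3k+1}+1}{3\gamma^{m+3k+1}},\qquad b_k=\frac{\gamma^{2m}+\gamma^{m+3k+1}+\gamma^{6k+2}}{3\gamma^{m+3k+1}},\qquad c_k=\frac{\gamma^{6k+2}+\gamma^{3k+1}+1}{3\gamma^{3k+1}}.$$ Then the trinomial $g_k(x)=a_kx^{2m+1}+b_kx^{m+1}+c_kx$ is a permutation polynomial over $\mathbf{F}_q$, and the permutation of $\mathbf{F}_q$ it induces is an involution with exactly $m+1$ fixed points.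
   Context: $\mathbf{F}_q$ denotes the finite field with $q$ elements. A permutation polynomial over $\mathbf{F}_q$ is a polynomial $g\in\mathbf{F}_q[x]$ whose associated map $\mathbf{F}_q\to\mathbf{F}_q$, $x\mapsto g(x)$, is a bijection; it is involutory if $g(g(x))=x$ for all $x\in\mathbf{F}_q$. -}

module Defs where

open import Data.Nat using (ℕ; zero; suc)
open import Data.Fin using (Fin)
open import Data.Product using (Σ)
open import Relation.Binary.PropositionalEquality using (_≡_; _≢_)
open import Algebra.Structures using (IsCommutativeRing)
open import Function.Bundles using (_↔_)

record FiniteField (q : ℕ) : Set₁ where
  infixl 6 _+F_
  infixl 7 _*F_
  infixr 8 _^F_
  infixl 7 _/F_
  field
    Carrier : Set
    _+F_ _*F_ : Carrier → Carrier → Carrier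
    -_      : Carrier → Carrier
    0# 1#   : Carrier
    isCommutativeRing : IsCommutativeRing _≡_ _+F_ _*F_ -_ 0# 1#
    0≢1     : 0# ≢ 1#
    _⁻¹     : Carrier → Carrier
    ⁻¹-inverse : ∀ x → x ≢ 0# → x *F (x ⁻¹) ≡ 1#
    card    : Fin q ↔ Carrier

  _^F_ : Carrier → ℕ → Carrier
  x ^F zero  = 1#
  x ^F suc n = x *F (x ^F n)

  -- division (only meaningful for nonzero denominators)
  _/F_ : Carrier → Carrier → Carrier
  x /F y = x *F (y ⁻¹)

  3# : Carrier
  3# = 1# +F 1# +F 1#

  IsGenerator : Carrier → Set
  IsGenerator γ = ∀ x → x ≢ 0# → Σ ℕ (λ i → γ ^F i ≡ x)

  FixedPointsCount : (Carrier → Carrier) → ℕ → Set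
  FixedPointsCount g n = Fin n ↔ Σ Carrier (λ x → g x ≡ x)

{-# OPTIONS --safe #-}
module Submission where

-- Write q - 1 = 3m, w = γ^m and t = γ^(3k+1). Then w is a primitive cube root of unity, so
-- Φ₃(w) = w² + w + 1 = 0 and 3 ≠ 0, and t^m = w. For x ≠ 0 the power x^m is 1, w or w² according
-- to the index of x modulo 3, and g(x) = Q(x^m)·x where Q(e) = a e² + b e + c is the quadratic
-- taking the values 1, t, t⁻¹ at 1, w, w². So g fixes 0 and the m nonzero cubes, multiplies the
-- class x^m = w by t (landing in the class x^m = w²) and that class by t⁻¹: g is an involution
-- whose fixed points are 0 and the cubes.

open import Defs
open import Data.Nat using (ℕ; zero; suc; _+_; _*_; _∸_; _^_; _≤_; _<_; z≤n; s≤s; s≤s⁻¹; NonZero; >-nonZero; >-nonZero⁻¹; ≢-nonZero⁻¹)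
open import Data.Nat.DivMod using (_/_; _%_; m≡m%n+[m/n]*n; m%n<n; m*[n/m]≡n)
open import Data.Nat.Divisibility using (_∣_; divides; m%n≡0⇒n∣m; *-cancelʳ-∣)
open import Data.Nat.Primality using (Prime)
import Data.Nat.Properties as ℕ
open import Data.Nat.Tactic.RingSolver using (solve-∀)
open import Data.Fin as Fin using (Fin; toℕ; fromℕ<; punchIn; punchOut)
open import Data.Fin.Properties using (toℕ-injective; toℕ-fromℕ<; toℕ<n; pigeonhole; injective⇒≤; punchIn-injective; punchInᵢ≢i; punchOut-injective)
open import Data.Product using (Σ; _×_; _,_; proj₁; proj₂)
open import Data.Product.Properties using (Σ-≡,≡→≡)
open import Data.Sum using (_⊎_; inj₁; inj₂)
open import Relation.Nullary.Decidable using (via-injection; yes; no)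
open import Relation.Nullary.Negation using (contradiction)
open import Relation.Binary.Definitions using (DecidableEquality; tri<; tri≈; tri>)
open import Relation.Binary.PropositionalEquality
open import Axiom.UniquenessOfIdentityProofs using (UIP; module Decidable⇒UIP)
open import Function.Base using (_∘_)
open import Function.Bundles using (Inverse; Injection; Bijection; _↔_; mk↔ₛ′; mk⤖)
open import Function.Definitions using (Bijective; Injective; StrictlySurjective)
open import Function.Consequences.Propositional using (strictlySurjective⇒surjective)
open import Function.Properties.Inverse using (↔⇒↣; ↔⇒⤖; ↔-sym)
open import Function.Properties.Bijection using (⤖⇒↔)
open import Algebra.Bundles using (CommutativeRing)

involutive⇒bijective : ∀ {a} {A : Set a} {f : A → A} → (∀ x → f (f x) ≡ x) → Bijective _≡_ _≡_ f
involutive⇒bijective f∘f≡id = Bijection.bijective (↔⇒⤖ (mk↔ₛ′ _ _ f∘f≡id f∘f≡id))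

module FieldProperties {q : ℕ} (F : FiniteField q) where
  open FiniteField F

  commutativeRing : CommutativeRing _ _
  commutativeRing = record { isCommutativeRing = isCommutativeRing }

  open CommutativeRing commutativeRing using (commutativeSemiring; *-comm; *-identityˡ; *-identityʳ; zeroˡ)
  open import Algebra.Solver.Ring.NaturalCoefficients.Default commutativeSemiring
  open import Algebra.Properties.CommutativeSemiring.Exp commutativeSemiring
    using (^-homo-*; ^-assocʳ; ^-distrib-*) renaming (_^_ to _^ᴿ_)
  open ≡-Reasoning

  _≟_ : DecidableEquality Carrier
  _≟_ = via-injection (↔⇒↣ (↔-sym card)) Fin._≟_

  ≡-irrelevant : UIP Carrier
  ≡-irrelevant = Decidable⇒UIP.≡-irrelevant _≟_

  *-nonzero : ∀ {x y} → x ≢ 0# → y ≢ 0# → x *F y ≢ 0#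
  *-nonzero {x} {y} x≢0 y≢0 xy≡0 = 0≢1 (begin
    0#                            ≡⟨ sym (zeroˡ _) ⟩
    0# *F (x ⁻¹ *F y ⁻¹)          ≡⟨ cong (_*F (x ⁻¹ *F y ⁻¹)) (sym xy≡0) ⟩
    (x *F y) *F (x ⁻¹ *F y ⁻¹)    ≡⟨ solve 4 (λ x x' y y' → (x :* y) :* (x' :* y') := (x :* x') :* (y :* y')) refl x (x ⁻¹) y (y ⁻¹) ⟩
    (x *F x ⁻¹) *F (y *F y ⁻¹)    ≡⟨ cong₂ _*F_ (⁻¹-inverse x x≢0) (⁻¹-inverse y y≢0) ⟩
    1# *F 1#                      ≡⟨ *-identityˡ 1# ⟩
    1#                            ∎)

  ⁻¹-*-cancel : ∀ {x} → x ≢ 0# → ∀ y → x ⁻¹ *F (x *F y) ≡ y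
  ⁻¹-*-cancel {x} x≢0 y = begin
    x ⁻¹ *F (x *F y)  ≡⟨ solve 3 (λ x' x y → x' :* (x :* y) := (x :* x') :* y) refl (x ⁻¹) x y ⟩
    (x *F x ⁻¹) *F y  ≡⟨ cong (_*F y) (⁻¹-inverse x x≢0) ⟩
    1# *F y           ≡⟨ *-identityˡ y ⟩
    y                 ∎

  *-⁻¹-cancel : ∀ {x} → x ≢ 0# → ∀ y → x *F (x ⁻¹ *F y) ≡ y
  *-⁻¹-cancel {x} x≢0 y = begin
    x *F (x ⁻¹ *F y)  ≡⟨ solve 3 (λ x x' y → x :* (x' :* y) := (x :* x') :* y) refl x (x ⁻¹) y ⟩
    (x *F x ⁻¹) *F y  ≡⟨ cong (_*F y) (⁻¹-inverse x x≢0) ⟩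
    1# *F y           ≡⟨ *-identityˡ y ⟩
    y                 ∎

  *-cancelˡ-nonzero : ∀ {x y z} → z ≢ 0# → z *F x ≡ z *F y → x ≡ y
  *-cancelˡ-nonzero {x} {y} {z} z≢0 zx≡zy = begin
    x                   ≡⟨ sym (⁻¹-*-cancel z≢0 x) ⟩
    z ⁻¹ *F (z *F x)    ≡⟨ cong (z ⁻¹ *F_) zx≡zy ⟩
    z ⁻¹ *F (z *F y)    ≡⟨ ⁻¹-*-cancel z≢0 y ⟩
    y                   ∎

  *-cancelʳ-nonzero : ∀ {x y z} → z ≢ 0# → x *F z ≡ y *F z → x ≡ y
  *-cancelʳ-nonzero {x} {y} {z} z≢0 xz≡yz =
    *-cancelˡ-nonzero z≢0 (trans (*-comm z x) (trans xz≡yz (*-comm y z)))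

  x*x≡0⇒x≡0 : ∀ {x} → x *F x ≡ 0# → x ≡ 0#
  x*x≡0⇒x≡0 {x} xx≡0 with x ≟ 0#
  ... | yes x≡0 = x≡0
  ... | no x≢0  = contradiction xx≡0 (*-nonzero x≢0 x≢0)

  ⁻¹-unique : ∀ {x y} → x *F y ≡ 1# → x ⁻¹ ≡ y
  ⁻¹-unique {x} {y} xy≡1 = begin
    x ⁻¹                ≡⟨ sym (*-identityʳ _) ⟩
    x ⁻¹ *F 1#          ≡⟨ cong (x ⁻¹ *F_) (sym xy≡1) ⟩
    x ⁻¹ *F (x *F y)    ≡⟨ ⁻¹-*-cancel x≢0 y ⟩
    y                   ∎
    where
    x≢0 : x ≢ 0#
    x≢0 x≡0 = 0≢1 (trans (sym (zeroˡ y)) (trans (cong (_*F y) (sym x≡0)) xy≡1))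

  ^F≡^ᴿ : ∀ x n → x ^F n ≡ x ^ᴿ n
  ^F≡^ᴿ x zero    = refl
  ^F≡^ᴿ x (suc n) = cong (x *F_) (^F≡^ᴿ x n)

  ^F-homo-*F : ∀ x m n → x ^F (m + n) ≡ x ^F m *F x ^F n
  ^F-homo-*F x m n = begin
    x ^F (m + n)       ≡⟨ ^F≡^ᴿ x (m + n) ⟩
    x ^ᴿ (m + n)       ≡⟨ ^-homo-* x m n ⟩
    x ^ᴿ m *F x ^ᴿ n   ≡⟨ sym (cong₂ _*F_ (^F≡^ᴿ x m) (^F≡^ᴿ x n)) ⟩
    x ^F m *F x ^F n   ∎

  ^F-assocʳ : ∀ x m n → (x ^F m) ^F n ≡ x ^F (m * n)
  ^F-assocʳ x m n = begin
    (x ^F m) ^F n   ≡⟨ ^F≡^ᴿ (x ^F m) n ⟩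
    (x ^F m) ^ᴿ n   ≡⟨ cong (_^ᴿ n) (^F≡^ᴿ x m) ⟩
    (x ^ᴿ m) ^ᴿ n   ≡⟨ ^-assocʳ x m n ⟩
    x ^ᴿ (m * n)    ≡⟨ sym (^F≡^ᴿ x (m * n)) ⟩
    x ^F (m * n)    ∎

  ^F-distrib-*F : ∀ x y n → (x *F y) ^F n ≡ x ^F n *F y ^F n
  ^F-distrib-*F x y n = begin
    (x *F y) ^F n      ≡⟨ ^F≡^ᴿ (x *F y) n ⟩
    (x *F y) ^ᴿ n      ≡⟨ ^-distrib-* x y n ⟩
    x ^ᴿ n *F y ^ᴿ n   ≡⟨ sym (cong₂ _*F_ (^F≡^ᴿ x n) (^F≡^ᴿ y n)) ⟩
    x ^F n *F y ^F n   ∎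

  ^F-^F-comm : ∀ x m n → (x ^F m) ^F n ≡ (x ^F n) ^F m
  ^F-^F-comm x m n = begin
    (x ^F m) ^F n   ≡⟨ ^F-assocʳ x m n ⟩
    x ^F (m * n)    ≡⟨ cong (x ^F_) (ℕ.*-comm m n) ⟩
    x ^F (n * m)    ≡⟨ sym (^F-assocʳ x n m) ⟩
    (x ^F n) ^F m   ∎

  1^F≡1 : ∀ n → 1# ^F n ≡ 1#
  1^F≡1 zero    = refl
  1^F≡1 (suc n) = trans (*-identityˡ _) (1^F≡1 n)

  ^F-nonzero : ∀ {x} → x ≢ 0# → ∀ n → x ^F n ≢ 0#
  ^F-nonzero x≢0 zero    = 0≢1 ∘ sym
  ^F-nonzero x≢0 (suc n) = *-nonzero x≢0 (^F-nonzero x≢0 n)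

  ^F≡1⇒^F[*]≡1 : ∀ x d → x ^F d ≡ 1# → ∀ n → x ^F (d * n) ≡ 1#
  ^F≡1⇒^F[*]≡1 x d x^d≡1 n = begin
    x ^F (d * n)    ≡⟨ sym (^F-assocʳ x d n) ⟩
    (x ^F d) ^F n   ≡⟨ cong (_^F n) x^d≡1 ⟩
    1# ^F n         ≡⟨ 1^F≡1 n ⟩
    1#              ∎

  ^F-mod : ∀ x d .{{_ : NonZero d}} → x ^F d ≡ 1# → ∀ i → x ^F i ≡ x ^F (i % d)
  ^F-mod x d x^d≡1 i = begin
    x ^F i                             ≡⟨ cong (x ^F_) (m≡m%n+[m/n]*n i d) ⟩
    x ^F (i % d + i / d * d)           ≡⟨ ^F-homo-*F x (i % d) (i / d * d) ⟩
    x ^F (i % d) *F x ^F (i / d * d)   ≡⟨ cong (λ n → x ^F (i % d) *F x ^F n) (ℕ.*-comm (i / d) d) ⟩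
    x ^F (i % d) *F x ^F (d * (i / d)) ≡⟨ cong (x ^F (i % d) *F_) (^F≡1⇒^F[*]≡1 x d x^d≡1 (i / d)) ⟩
    x ^F (i % d) *F 1#                 ≡⟨ *-identityʳ _ ⟩
    x ^F (i % d)                       ∎

module _ {q : ℕ} (F : FiniteField q) where
  open FiniteField F
  open FieldProperties F
  open CommutativeRing commutativeRing using (commutativeSemiring; *-identityˡ; *-identityʳ; +-identityˡ; +-identityʳ)
  open import Algebra.Solver.Ring.NaturalCoefficients.Default commutativeSemiring
  open ≡-Reasoning

  Φ₃ : Carrier → Carrier
  Φ₃ x = x ^F 2 +F x +F 1#

  module PrimitiveCubeRoot {w : Carrier} (w³≡1 : w ^F 3 ≡ 1#) (w≢1 : w ≢ 1#) where
    Φ₃[w]≡0 : Φ₃ w ≡ 0#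
    Φ₃[w]≡0 with Φ₃ w ≟ 0#
    ... | yes Φ₃[w]≡0 = Φ₃[w]≡0
    ... | no Φ₃[w]≢0  = contradiction (*-cancelʳ-nonzero Φ₃[w]≢0 (begin
      w *F Φ₃ w                 ≡⟨ solve 1 (λ w → w :* (w :^ 2 :+ w :+ con 1) := w :^ 3 :+ w :^ 2 :+ w) refl w ⟩
      w ^F 3 +F w ^F 2 +F w     ≡⟨ cong (λ c → c +F w ^F 2 +F w) w³≡1 ⟩
      1# +F w ^F 2 +F w         ≡⟨ solve 1 (λ w → con 1 :+ w :^ 2 :+ w := con 1 :* (w :^ 2 :+ w :+ con 1)) refl w ⟩
      1# *F Φ₃ w                ∎)) w≢1

    3≢0 : 3# ≢ 0#
    3≢0 3≡0 = w≢1 (begin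
      w                      ≡⟨ sym (+-identityʳ w) ⟩
      w +F 0#                ≡⟨ cong (w +F_) (sym 3≡0) ⟩
      w +F 3#                ≡⟨ solve 1 (λ w → w :+ con 3 := (w :+ con 1 :+ con 1) :+ con 1) refl w ⟩
      (w +F 1# +F 1#) +F 1#  ≡⟨ cong (_+F 1#) w+2≡0 ⟩
      0# +F 1#               ≡⟨ +-identityˡ 1# ⟩
      1#                     ∎)
      where
      w+2≡0 : w +F 1# +F 1# ≡ 0#
      w+2≡0 = x*x≡0⇒x≡0 (begin
        (w +F 1# +F 1#) *F (w +F 1# +F 1#)  ≡⟨ solve 1 (λ w → (w :+ con 1 :+ con 1) :* (w :+ con 1 :+ con 1) := (w :^ 2 :+ w :+ con 1) :+ con 3 :* (w :+ con 1)) refl w ⟩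
        Φ₃ w +F 3# *F (w +F 1#)            ≡⟨ cong₂ (λ Φ c → Φ +F c *F (w +F 1#)) Φ₃[w]≡0 3≡0 ⟩
        0# +F 0# *F (w +F 1#)              ≡⟨ solve 1 (λ w → con 0 :+ con 0 :* (w :+ con 1) := con 0) refl w ⟩
        0#                                 ∎)

  module Interpolation {w t : Carrier} (3≢0 : 3# ≢ 0#) (Φ₃[w]≡0 : Φ₃ w ≡ 0#) (t≢0 : t ≢ 0#) where
    a b c : Carrier
    a = ((w *F t) ^F 2 +F w *F t +F 1#) /F (3# *F (w *F t))
    b = (w ^F 2 +F w *F t +F t ^F 2) /F (3# *F (w *F t))
    c = (t ^F 2 +F t +F 1#) /F (3# *F t)

    quadratic : Carrier → Carrier
    quadratic e = a *F e ^F 2 +F b *F e +F c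

    private
      w≢0 : w ≢ 0#
      w≢0 w≡0 = 0≢1 (begin
        0#                     ≡⟨ sym Φ₃[w]≡0 ⟩
        Φ₃ w                   ≡⟨ cong Φ₃ w≡0 ⟩
        Φ₃ 0#                  ≡⟨ solve 0 (con 0 :^ 2 :+ con 0 :+ con 1 := con 1) refl ⟩
        1#                     ∎)

      v : Carrier
      v = (3# *F (w *F t)) ⁻¹

      3wt·v≡1 : 3# *F (w *F t) *F v ≡ 1#
      3wt·v≡1 = ⁻¹-inverse _ (*-nonzero 3≢0 (*-nonzero w≢0 t≢0))

      [3t]⁻¹≡w·v : (3# *F t) ⁻¹ ≡ w *F v
      [3t]⁻¹≡w·v = ⁻¹-unique (trans (solve 3 (λ w t v → con 3 :* t :* (w :* v) := con 3 :* (w :* t) :* v) refl w t v) 3wt·v≡1)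

      t⁻¹≡3w·v : t ⁻¹ ≡ 3# *F w *F v
      t⁻¹≡3w·v = ⁻¹-unique (trans (solve 3 (λ w t v → t :* (con 3 :* w :* v) := con 3 :* (w :* t) :* v) refl w t v) 3wt·v≡1)

      numerator : Carrier → Carrier
      numerator e = ((w *F t) ^F 2 +F w *F t +F 1#) *F e ^F 2 +F (w ^F 2 +F w *F t +F t ^F 2) *F e +F (t ^F 2 +F t +F 1#) *F w

      numeratorᴾ : ∀ {n} → Polynomial n → Polynomial n → Polynomial n → Polynomial n
      numeratorᴾ w t e = ((w :* t) :^ 2 :+ w :* t :+ con 1) :* e :^ 2 :+ (w :^ 2 :+ w :* t :+ t :^ 2) :* e :+ (t :^ 2 :+ t :+ con 1) :* w

      Φ₃ᴾ : ∀ {n} → Polynomial n → Polynomial n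
      Φ₃ᴾ w = w :^ 2 :+ w :+ con 1

      quadratic≡numerator·v : ∀ e → quadratic e ≡ numerator e *F v
      quadratic≡numerator·v e = begin
        quadratic e
          ≡⟨ cong (λ i → a *F e ^F 2 +F b *F e +F (t ^F 2 +F t +F 1#) *F i) [3t]⁻¹≡w·v ⟩
        a *F e ^F 2 +F b *F e +F (t ^F 2 +F t +F 1#) *F (w *F v)
          ≡⟨ solve 4 (λ w t v e →
               ((w :* t) :^ 2 :+ w :* t :+ con 1) :* v :* e :^ 2 :+ (w :^ 2 :+ w :* t :+ t :^ 2) :* v :* e
                 :+ (t :^ 2 :+ t :+ con 1) :* (w :* v)
               := numeratorᴾ w t e :* v) refl w t v e ⟩
        numerator e *F v ∎

      cancel-Φ₃ : ∀ {x y r s} → x +F r *F Φ₃ w ≡ y +F s *F Φ₃ w → x ≡ y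
      cancel-Φ₃ {x} {y} {r} {s} eq = begin
        x                 ≡⟨ solve 2 (λ x r → x := x :+ r :* con 0) refl x r ⟩
        x +F r *F 0#      ≡⟨ cong (λ Φ → x +F r *F Φ) (sym Φ₃[w]≡0) ⟩
        x +F r *F Φ₃ w    ≡⟨ eq ⟩
        y +F s *F Φ₃ w    ≡⟨ cong (λ Φ → y +F s *F Φ) Φ₃[w]≡0 ⟩
        y +F s *F 0#      ≡⟨ solve 2 (λ y s → y :+ s :* con 0 := y) refl y s ⟩
        y                 ∎

      -- Each identity holds modulo Φ₃ w; a multiple of Φ₃ w is added to both sides so that no
      -- subtraction is needed.
      numerator[1] : numerator 1# ≡ 3# *F (w *F t)
      numerator[1] = cancel-Φ₃ {r = 0#} (solve 2 (λ w t →
        numeratorᴾ w t (con 1) :+ con 0 :* Φ₃ᴾ w := con 3 :* (w :* t) :+ (t :^ 2 :+ con 1) :* Φ₃ᴾ w) refl w t)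

      numerator[w] : numerator w ≡ 3# *F (w *F t) *F t
      numerator[w] = cancel-Φ₃ (solve 2 (λ w t →
        numeratorᴾ w t w :+ w :* t :^ 2 :* Φ₃ᴾ w := con 3 :* (w :* t) :* t :+ (w :^ 2 :* t :^ 2 :+ w :* t :+ w) :* Φ₃ᴾ w) refl w t)

      numerator[w²] : numerator (w ^F 2) ≡ 3# *F w
      numerator[w²] = cancel-Φ₃ (solve 2 (λ w t →
        numeratorᴾ w t (w :^ 2) :+ (w :^ 3 :* t :^ 2 :+ w :^ 2 :* t :+ con 2 :* w) :* Φ₃ᴾ w
          := con 3 :* w :+ ((w :^ 4 :+ w) :* t :^ 2 :+ (w :^ 3 :+ w) :* t :+ con 2 :* w :^ 2) :* Φ₃ᴾ w) refl w t)

    quadratic[1] : quadratic 1# ≡ 1#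
    quadratic[1] = begin
      quadratic 1#               ≡⟨ quadratic≡numerator·v 1# ⟩
      numerator 1# *F v          ≡⟨ cong (_*F v) numerator[1] ⟩
      3# *F (w *F t) *F v        ≡⟨ 3wt·v≡1 ⟩
      1#                         ∎

    quadratic[w] : quadratic w ≡ t
    quadratic[w] = begin
      quadratic w                ≡⟨ quadratic≡numerator·v w ⟩
      numerator w *F v           ≡⟨ cong (_*F v) numerator[w] ⟩
      3# *F (w *F t) *F t *F v   ≡⟨ solve 3 (λ w t v → con 3 :* (w :* t) :* t :* v := t :* (con 3 :* (w :* t) :* v)) refl w t v ⟩
      t *F (3# *F (w *F t) *F v) ≡⟨ cong (t *F_) 3wt·v≡1 ⟩
      t *F 1#                    ≡⟨ *-identityʳ t ⟩
      t                          ∎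

    quadratic[w²] : quadratic (w ^F 2) ≡ t ⁻¹
    quadratic[w²] = begin
      quadratic (w ^F 2)         ≡⟨ quadratic≡numerator·v (w ^F 2) ⟩
      numerator (w ^F 2) *F v    ≡⟨ cong (_*F v) numerator[w²] ⟩
      3# *F w *F v               ≡⟨ sym t⁻¹≡3w·v ⟩
      t ⁻¹                       ∎

  trinomial : (a b c : Carrier) → ℕ → Carrier → Carrier
  trinomial a b c m x = a *F x ^F (2 * m + 1) +F b *F x ^F (m + 1) +F c *F x

  aₖ bₖ : Carrier → ℕ → ℕ → Carrier
  aₖ γ m k = (γ ^F (2 * m + 6 * k + 2) +F γ ^F (m + 3 * k + 1) +F 1#) /F (3# *F γ ^F (m + 3 * k + 1))
  bₖ γ m k = (γ ^F (2 * m) +F γ ^F (m + 3 * k + 1) +F γ ^F (6 * k + 2)) /F (3# *F γ ^F (m + 3 * k + 1))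

  cₖ : Carrier → ℕ → Carrier
  cₖ γ k = (γ ^F (6 * k + 2) +F γ ^F (3 * k + 1) +F 1#) /F (3# *F γ ^F (3 * k + 1))

  gₖ : Carrier → ℕ → ℕ → Carrier → Carrier
  gₖ γ m k = trinomial (aₖ γ m k) (bₖ γ m k) (cₖ γ k) m

  trinomial≡quadratic·x : ∀ a b c m x → trinomial a b c m x ≡ (a *F (x ^F m) ^F 2 +F b *F x ^F m +F c) *F x
  trinomial≡quadratic·x a b c m x = begin
    a *F x ^F (2 * m + 1) +F b *F x ^F (m + 1) +F c *F x
      ≡⟨ cong₂ (λ u v → a *F u +F b *F v +F c *F x) x^[2m+1] (^F-homo-*F x m 1) ⟩
    a *F ((x ^F m) ^F 2 *F x ^F 1) +F b *F (x ^F m *F x ^F 1) +F c *F x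
      ≡⟨ solve 5 (λ a b c e x → a :* (e :^ 2 :* x :^ 1) :+ b :* (e :* x :^ 1) :+ c :* x := (a :* e :^ 2 :+ b :* e :+ c) :* x) refl a b c (x ^F m) x ⟩
    (a *F (x ^F m) ^F 2 +F b *F x ^F m +F c) *F x ∎
    where
    x^[2m+1] : x ^F (2 * m + 1) ≡ (x ^F m) ^F 2 *F x ^F 1
    x^[2m+1] = begin
      x ^F (2 * m + 1)            ≡⟨ cong (λ n → x ^F (n + 1)) (ℕ.*-comm 2 m) ⟩
      x ^F (m * 2 + 1)            ≡⟨ ^F-homo-*F x (m * 2) 1 ⟩
      x ^F (m * 2) *F x ^F 1      ≡⟨ cong (_*F x ^F 1) (sym (^F-assocʳ x m 2)) ⟩
      (x ^F m) ^F 2 *F x ^F 1     ∎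

module _ {N : ℕ} (F : FiniteField (suc N)) where
  open FiniteField F
  open FieldProperties F
  open Injection (↔⇒↣ card) using (to) renaming (injective to to-injective)
  open Injection (↔⇒↣ (↔-sym card)) using () renaming (to to from; injective to from-injective)
  open Inverse card using (strictlyInverseˡ)
  open CommutativeRing commutativeRing using (zeroˡ; *-identityʳ)
  open ≡-Reasoning

  private
    from0≢from : ∀ {x} → x ≢ 0# → from 0# ≢ from x
    from0≢from x≢0 = x≢0 ∘ sym ∘ from-injective

  nonzeroIndex : (x : Carrier) → x ≢ 0# → Fin N
  nonzeroIndex x x≢0 = punchOut (from0≢from x≢0)

  nonzeroIndex-injective : ∀ {x y} x≢0 y≢0 → nonzeroIndex x x≢0 ≡ nonzeroIndex y y≢0 → x ≡ y
  nonzeroIndex-injective x≢0 y≢0 = from-injective ∘ punchOut-injective (from0≢from x≢0) (from0≢from y≢0)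

  nonzeroElement : Fin N → Carrier
  nonzeroElement = to ∘ punchIn (from 0#)

  nonzeroElement-nonzero : ∀ i → nonzeroElement i ≢ 0#
  nonzeroElement-nonzero i x≡0 =
    punchInᵢ≢i (from 0#) i (to-injective (trans x≡0 (sym (strictlyInverseˡ 0#))))

  nonzero-injective⇒≤ : ∀ {S} (f : (x : Carrier) → x ≢ 0# → Fin S) →
                        (∀ {x y} x≢0 y≢0 → f x x≢0 ≡ f y y≢0 → x ≡ y) → N ≤ S
  nonzero-injective⇒≤ f f-injective = injective⇒≤ {f = λ i → f (nonzeroElement i) (nonzeroElement-nonzero i)}
    (punchIn-injective (from 0#) _ _ ∘ to-injective ∘ f-injective _ _)

  generator-nonzero : 2 ≤ N → ∀ {γ} → IsGenerator γ → γ ≢ 0#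
  generator-nonzero 2≤N {γ} gen γ≡0 =
    ℕ.<⇒≱ 2≤N (nonzero-injective⇒≤ (λ _ _ → Fin.zero) (λ x≢0 y≢0 _ → trans (nonzero≡1 x≢0) (sym (nonzero≡1 y≢0))))
    where
    nonzero≡1 : ∀ {x} → x ≢ 0# → x ≡ 1#
    nonzero≡1 {x} x≢0 with gen x x≢0
    ... | zero  , 1≡x     = sym 1≡x
    ... | suc i , γ^1+i≡x = contradiction (trans (sym γ^1+i≡x) (trans (cong (_^F suc i) γ≡0) (zeroˡ _))) x≢0

  module Generator .{{_ : NonZero N}} {γ : Carrier} (gen : IsGenerator γ) (γ≢0 : γ ≢ 0#) where
    N≤period : ∀ {d} → 0 < d → γ ^F d ≡ 1# → N ≤ d
    N≤period {d} 0<d γ^d≡1 = nonzero-injective⇒≤ index%d index%d-injective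
      where
      instance _ = >-nonZero 0<d
      index : (x : Carrier) → x ≢ 0# → ℕ
      index x x≢0 = proj₁ (gen x x≢0)
      index%d : (x : Carrier) → x ≢ 0# → Fin d
      index%d x x≢0 = fromℕ< (m%n<n (index x x≢0) d)
      γ^index%d : ∀ {x} x≢0 → γ ^F toℕ (index%d x x≢0) ≡ x
      γ^index%d {x} x≢0 = begin
        γ ^F toℕ (index%d x x≢0)  ≡⟨ cong (γ ^F_) (toℕ-fromℕ< (m%n<n (index x x≢0) d)) ⟩
        γ ^F (index x x≢0 % d)    ≡⟨ sym (^F-mod γ d γ^d≡1 (index x x≢0)) ⟩
        γ ^F index x x≢0          ≡⟨ proj₂ (gen x x≢0) ⟩
        x                         ∎
      index%d-injective : ∀ {x y} x≢0 y≢0 → index%d x x≢0 ≡ index%d y y≢0 → x ≡ y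
      index%d-injective x≢0 y≢0 same =
        trans (sym (γ^index%d x≢0)) (trans (cong (λ i → γ ^F toℕ i) same) (γ^index%d y≢0))

    γ^[b∸a]≡1 : ∀ {a b} → a ≤ b → γ ^F a ≡ γ ^F b → γ ^F (b ∸ a) ≡ 1#
    γ^[b∸a]≡1 {a} {b} a≤b γ^a≡γ^b = *-cancelˡ-nonzero (^F-nonzero γ≢0 a) (begin
      γ ^F a *F γ ^F (b ∸ a)  ≡⟨ sym (^F-homo-*F γ a (b ∸ a)) ⟩
      γ ^F (a + (b ∸ a))      ≡⟨ cong (γ ^F_) (ℕ.m+[n∸m]≡n a≤b) ⟩
      γ ^F b                  ≡⟨ sym γ^a≡γ^b ⟩
      γ ^F a                  ≡⟨ sym (*-identityʳ _) ⟩
      γ ^F a *F 1#            ∎)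

    ∃period≤N : Σ ℕ λ d → 0 < d × d ≤ N × γ ^F d ≡ 1#
    ∃period≤N =
      let i , j , i<j , same = pigeonhole (ℕ.n<1+n N) (λ i → nonzeroIndex (γ ^F toℕ i) (^F-nonzero γ≢0 (toℕ i)))
      in toℕ j ∸ toℕ i , ℕ.m<n⇒0<n∸m i<j , ℕ.≤-trans (ℕ.m∸n≤m (toℕ j) (toℕ i)) (s≤s⁻¹ (toℕ<n j)) ,
         γ^[b∸a]≡1 (ℕ.<⇒≤ i<j) (nonzeroIndex-injective (^F-nonzero γ≢0 (toℕ i)) (^F-nonzero γ≢0 (toℕ j)) same)

    γ^N≡1 : γ ^F N ≡ 1#
    γ^N≡1 =
      let d , 0<d , d≤N , γ^d≡1 = ∃period≤N
      in subst (λ e → γ ^F e ≡ 1#) (ℕ.≤-antisym d≤N (N≤period 0<d γ^d≡1)) γ^d≡1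

    γ^≢γ^ : ∀ {a b} → a < b → b < N → γ ^F a ≢ γ ^F b
    γ^≢γ^ {a} {b} a<b b<N γ^a≡γ^b = ℕ.<⇒≱ (ℕ.≤-<-trans (ℕ.m∸n≤m b a) b<N)
      (N≤period (ℕ.m<n⇒0<n∸m a<b) (γ^[b∸a]≡1 (ℕ.<⇒≤ a<b) γ^a≡γ^b))

    γ^-injective : ∀ {a b} → a < N → b < N → γ ^F a ≡ γ ^F b → a ≡ b
    γ^-injective {a} {b} a<N b<N γ^a≡γ^b with ℕ.<-cmp a b
    ... | tri< a<b _ _ = contradiction γ^a≡γ^b (γ^≢γ^ a<b b<N)
    ... | tri≈ _ a≡b _ = a≡b
    ... | tri> _ _ b<a = contradiction (sym γ^a≡γ^b) (γ^≢γ^ b<a a<N)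

    γ^≡1⇒N∣ : ∀ {i} → γ ^F i ≡ 1# → N ∣ i
    γ^≡1⇒N∣ {i} γ^i≡1 = m%n≡0⇒n∣m i N
      (γ^-injective (m%n<n i N) (>-nonZero⁻¹ N) (trans (sym (^F-mod γ N γ^N≡1 i)) γ^i≡1))

module _ {m : ℕ} .{{_ : NonZero m}} (F : FiniteField (suc (3 * m))) where
  open FiniteField F
  open FieldProperties F
  open CommutativeRing commutativeRing using (*-identityˡ; *-identityʳ; zeroʳ)
  open ≡-Reasoning
  private instance _ = ℕ.m*n≢0 3 m

  module _ {γ : Carrier} (gen : IsGenerator γ) where
    γ≢0 : γ ≢ 0#
    γ≢0 = generator-nonzero F (ℕ.≤-trans (s≤s (s≤s z≤n)) (ℕ.*-monoʳ-≤ 3 (>-nonZero⁻¹ m))) gen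

    open Generator F gen γ≢0

    w : Carrier
    w = γ ^F m

    w³≡1 : w ^F 3 ≡ 1#
    w³≡1 = trans (^F-assocʳ γ m 3) (trans (cong (γ ^F_) (ℕ.*-comm m 3)) γ^N≡1)

    w≢1 : w ≢ 1#
    w≢1 w≡1 = ≢-nonZero⁻¹ m (γ^-injective m<3m (>-nonZero⁻¹ (3 * m)) w≡1)
      where
      m<3m : m < 3 * m
      m<3m = subst (m <_) (ℕ.*-comm m 3) (ℕ.m<m*n m 3 (s≤s (s≤s z≤n)))

    w·w≡w² : w *F w ≡ w ^F 2
    w·w≡w² = cong (w *F_) (sym (*-identityʳ w))

    ^m-trichotomy : ∀ {x} → x ≢ 0# → x ^F m ≡ 1# ⊎ x ^F m ≡ w ⊎ x ^F m ≡ w ^F 2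
    ^m-trichotomy {x} x≢0 with gen x x≢0
    ... | i , refl = classify (i % 3) (m%n<n i 3) (trans (^F-^F-comm γ i m) (^F-mod w 3 w³≡1 i))
      where
      classify : ∀ {y} r → r < 3 → y ≡ w ^F r → y ≡ 1# ⊎ y ≡ w ⊎ y ≡ w ^F 2
      classify 0 _ y≡1  = inj₁ y≡1
      classify 1 _ y≡w¹ = inj₂ (inj₁ (trans y≡w¹ (*-identityʳ w)))
      classify 2 _ y≡w² = inj₂ (inj₂ y≡w²)
      classify (suc (suc (suc _))) (s≤s (s≤s (s≤s ()))) _

    ζ : Carrier
    ζ = γ ^F 3

    ζ^m≡1 : ζ ^F m ≡ 1#
    ζ^m≡1 = trans (^F-assocʳ γ 3 m) γ^N≡1

    cube : Fin m → Carrier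
    cube j = ζ ^F toℕ j

    cube-nonzero : ∀ j → cube j ≢ 0#
    cube-nonzero j = ^F-nonzero (^F-nonzero γ≢0 3) (toℕ j)

    cube^m≡1 : ∀ j → cube j ^F m ≡ 1#
    cube^m≡1 j = begin
      (ζ ^F toℕ j) ^F m   ≡⟨ ^F-^F-comm ζ (toℕ j) m ⟩
      (ζ ^F m) ^F toℕ j   ≡⟨ cong (_^F toℕ j) ζ^m≡1 ⟩
      1# ^F toℕ j         ≡⟨ 1^F≡1 (toℕ j) ⟩
      1#                  ∎

    cube-injective : Injective _≡_ _≡_ cube
    cube-injective {i} {j} cube-i≡cube-j = toℕ-injective (ℕ.*-cancelˡ-≡ (toℕ i) (toℕ j) 3
      (γ^-injective (ℕ.*-monoʳ-< 3 (toℕ<n i)) (ℕ.*-monoʳ-< 3 (toℕ<n j))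
        (trans (sym (^F-assocʳ γ 3 (toℕ i))) (trans cube-i≡cube-j (^F-assocʳ γ 3 (toℕ j))))))

    γ^i^m≡1⇒3∣i : ∀ i → (γ ^F i) ^F m ≡ 1# → 3 ∣ i
    γ^i^m≡1⇒3∣i i γ^i^m≡1 = *-cancelʳ-∣ {3} {i} m (γ^≡1⇒N∣ {i * m} (trans (sym (^F-assocʳ γ i m)) γ^i^m≡1))

    cube-surjective : ∀ {x} → x ≢ 0# → x ^F m ≡ 1# → Σ (Fin m) λ j → cube j ≡ x
    cube-surjective {x} x≢0 x^m≡1 =
      let i , γ^i≡x = gen x x≢0
          divides j i≡j*3 = γ^i^m≡1⇒3∣i i (trans (cong (_^F m) γ^i≡x) x^m≡1)
      in fromℕ< (m%n<n j m) , (begin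
        ζ ^F toℕ (fromℕ< (m%n<n j m))  ≡⟨ cong (ζ ^F_) (toℕ-fromℕ< (m%n<n j m)) ⟩
        ζ ^F (j % m)                    ≡⟨ sym (^F-mod ζ m ζ^m≡1 j) ⟩
        ζ ^F j                          ≡⟨ ^F-assocʳ γ 3 j ⟩
        γ ^F (3 * j)                    ≡⟨ cong (γ ^F_) (trans (ℕ.*-comm 3 j) (sym i≡j*3)) ⟩
        γ ^F i                          ≡⟨ γ^i≡x ⟩
        x                               ∎)

    module Trinomial (k : ℕ) where
      t : Carrier
      t = γ ^F (3 * k + 1)

      t≢0 : t ≢ 0#
      t≢0 = ^F-nonzero γ≢0 (3 * k + 1)

      t^m≡w : t ^F m ≡ w
      t^m≡w = begin
        (γ ^F (3 * k + 1)) ^F m      ≡⟨ ^F-^F-comm γ (3 * k + 1) m ⟩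
        w ^F (3 * k + 1)             ≡⟨ ^F-homo-*F w (3 * k) 1 ⟩
        w ^F (3 * k) *F w ^F 1       ≡⟨ cong (_*F w ^F 1) (^F≡1⇒^F[*]≡1 w 3 w³≡1 k) ⟩
        1# *F w ^F 1                 ≡⟨ *-identityˡ _ ⟩
        w *F 1#                      ≡⟨ *-identityʳ w ⟩
        w                            ∎

      t≢1 : t ≢ 1#
      t≢1 t≡1 = w≢1 (trans (sym t^m≡w) (trans (cong (_^F m) t≡1) (1^F≡1 m)))

      open PrimitiveCubeRoot F w³≡1 w≢1
      open Interpolation F 3≢0 Φ₃[w]≡0 t≢0

      g : Carrier → Carrier
      g = gₖ F γ m k

      γ^[m+3k+1]≡w·t : γ ^F (m + 3 * k + 1) ≡ w *F t
      γ^[m+3k+1]≡w·t = trans (cong (γ ^F_) (ℕ.+-assoc m (3 * k) 1)) (^F-homo-*F γ m (3 * k + 1))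

      γ^[2m+6k+2]≡[w·t]² : γ ^F (2 * m + 6 * k + 2) ≡ (w *F t) ^F 2
      γ^[2m+6k+2]≡[w·t]² = begin
        γ ^F (2 * m + 6 * k + 2)      ≡⟨ cong (γ ^F_) (2m+6k+2≡[m+3k+1]*2 m k) ⟩
        γ ^F ((m + 3 * k + 1) * 2)    ≡⟨ sym (^F-assocʳ γ (m + 3 * k + 1) 2) ⟩
        (γ ^F (m + 3 * k + 1)) ^F 2   ≡⟨ cong (_^F 2) γ^[m+3k+1]≡w·t ⟩
        (w *F t) ^F 2                 ∎
        where
        2m+6k+2≡[m+3k+1]*2 : ∀ m k → 2 * m + 6 * k + 2 ≡ (m + 3 * k + 1) * 2
        2m+6k+2≡[m+3k+1]*2 = solve-∀

      γ^[2m]≡w² : γ ^F (2 * m) ≡ w ^F 2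
      γ^[2m]≡w² = trans (cong (γ ^F_) (ℕ.*-comm 2 m)) (sym (^F-assocʳ γ m 2))

      γ^[6k+2]≡t² : γ ^F (6 * k + 2) ≡ t ^F 2
      γ^[6k+2]≡t² = trans (cong (γ ^F_) (6k+2≡[3k+1]*2 k)) (sym (^F-assocʳ γ (3 * k + 1) 2))
        where
        6k+2≡[3k+1]*2 : ∀ k → 6 * k + 2 ≡ (3 * k + 1) * 2
        6k+2≡[3k+1]*2 = solve-∀

      aₖ≡a : aₖ F γ m k ≡ a
      aₖ≡a = cong₂ (λ γ²ⁿ γⁿ → (γ²ⁿ +F γⁿ +F 1#) /F (3# *F γⁿ)) γ^[2m+6k+2]≡[w·t]² γ^[m+3k+1]≡w·t

      bₖ≡b : bₖ F γ m k ≡ b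
      bₖ≡b = begin
        bₖ F γ m k
          ≡⟨ cong₂ (λ γ²ᵐ γ⁶ᵏ⁺² → (γ²ᵐ +F γ ^F (m + 3 * k + 1) +F γ⁶ᵏ⁺²) /F (3# *F γ ^F (m + 3 * k + 1)))
                   γ^[2m]≡w² γ^[6k+2]≡t² ⟩
        (w ^F 2 +F γ ^F (m + 3 * k + 1) +F t ^F 2) /F (3# *F γ ^F (m + 3 * k + 1))
          ≡⟨ cong (λ γⁿ → (w ^F 2 +F γⁿ +F t ^F 2) /F (3# *F γⁿ)) γ^[m+3k+1]≡w·t ⟩
        b ∎

      cₖ≡c : cₖ F γ k ≡ c
      cₖ≡c = cong (λ γ⁶ᵏ⁺² → (γ⁶ᵏ⁺² +F t +F 1#) /F (3# *F t)) γ^[6k+2]≡t²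

      g≡quadratic·x : ∀ x → g x ≡ quadratic (x ^F m) *F x
      g≡quadratic·x x = begin
        g x                              ≡⟨ cong₂ (λ a′ b′ → trinomial F a′ b′ (cₖ F γ k) m x) aₖ≡a bₖ≡b ⟩
        trinomial F a b (cₖ F γ k) m x   ≡⟨ cong (λ c′ → trinomial F a b c′ m x) cₖ≡c ⟩
        trinomial F a b c m x            ≡⟨ trinomial≡quadratic·x F a b c m x ⟩
        quadratic (x ^F m) *F x          ∎

      g-on-class : ∀ {x e} → x ^F m ≡ e → g x ≡ quadratic e *F x
      g-on-class {x} x^m≡e = trans (g≡quadratic·x x) (cong (λ e → quadratic e *F x) x^m≡e)

      g-fixes-cubes : ∀ {x} → x ^F m ≡ 1# → g x ≡ x
      g-fixes-cubes {x} x^m≡1 = trans (g-on-class x^m≡1) (trans (cong (_*F x) quadratic[1]) (*-identityˡ x))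

      g-on-class-w : ∀ {x} → x ^F m ≡ w → g x ≡ t *F x
      g-on-class-w x^m≡w = trans (g-on-class x^m≡w) (cong (_*F _) quadratic[w])

      g-on-class-w² : ∀ {x} → x ^F m ≡ w ^F 2 → g x ≡ t ⁻¹ *F x
      g-on-class-w² x^m≡w² = trans (g-on-class x^m≡w²) (cong (_*F _) quadratic[w²])

      g0≡0 : g 0# ≡ 0#
      g0≡0 = trans (g≡quadratic·x 0#) (zeroʳ _)

      [t·x]^m≡w·x^m : ∀ x → (t *F x) ^F m ≡ w *F x ^F m
      [t·x]^m≡w·x^m x = trans (^F-distrib-*F t x m) (cong (_*F x ^F m) t^m≡w)

      involutive : ∀ x → g (g x) ≡ x
      involutive x with x ≟ 0#
      ... | yes refl = trans (cong g g0≡0) g0≡0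
      ... | no x≢0 with ^m-trichotomy x≢0
      ... | inj₁ x^m≡1 = trans (cong g (g-fixes-cubes x^m≡1)) (g-fixes-cubes x^m≡1)
      ... | inj₂ (inj₁ x^m≡w) = begin
        g (g x)              ≡⟨ cong g (g-on-class-w x^m≡w) ⟩
        g (t *F x)           ≡⟨ g-on-class-w² (trans ([t·x]^m≡w·x^m x) (trans (cong (w *F_) x^m≡w) w·w≡w²)) ⟩
        t ⁻¹ *F (t *F x)     ≡⟨ ⁻¹-*-cancel t≢0 x ⟩
        x                    ∎
      ... | inj₂ (inj₂ x^m≡w²) = begin
        g (g x)              ≡⟨ cong g (g-on-class-w² x^m≡w²) ⟩
        g y                  ≡⟨ g-on-class-w y^m≡w ⟩
        t *F y               ≡⟨ *-⁻¹-cancel t≢0 x ⟩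
        x                    ∎
        where
        y = t ⁻¹ *F x
        y^m≡w : y ^F m ≡ w
        y^m≡w = *-cancelˡ-nonzero (^F-nonzero γ≢0 m) (begin
          w *F y ^F m          ≡⟨ sym ([t·x]^m≡w·x^m y) ⟩
          (t *F y) ^F m        ≡⟨ cong (_^F m) (*-⁻¹-cancel t≢0 x) ⟩
          x ^F m               ≡⟨ x^m≡w² ⟩
          w ^F 2               ≡⟨ sym w·w≡w² ⟩
          w *F w               ∎)

      fixed⇒cube : ∀ {x} → x ≢ 0# → g x ≡ x → x ^F m ≡ 1#
      fixed⇒cube {x} x≢0 gx≡x with ^m-trichotomy x≢0
      ... | inj₁ x^m≡1 = x^m≡1
      ... | inj₂ (inj₁ x^m≡w) =
        contradiction (*-cancelʳ-nonzero x≢0 (trans (sym (g-on-class-w x^m≡w)) (trans gx≡x (sym (*-identityˡ x))))) t≢1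
      ... | inj₂ (inj₂ x^m≡w²) = contradiction (*-cancelʳ-nonzero x≢0 (begin
        t *F x               ≡⟨ cong (t *F_) (trans (sym gx≡x) (g-on-class-w² x^m≡w²)) ⟩
        t *F (t ⁻¹ *F x)     ≡⟨ *-⁻¹-cancel t≢0 x ⟩
        x                    ≡⟨ sym (*-identityˡ x) ⟩
        1# *F x              ∎)) t≢1

      FixedPoint : Set
      FixedPoint = Σ Carrier λ x → g x ≡ x

      fixedPoint : Fin (suc m) → FixedPoint
      fixedPoint Fin.zero    = 0# , g0≡0
      fixedPoint (Fin.suc j) = cube j , g-fixes-cubes (cube^m≡1 j)

      fixedPoint-injective : Injective _≡_ _≡_ fixedPoint
      fixedPoint-injective {Fin.zero}  {Fin.zero}  _  = refl
      fixedPoint-injective {Fin.zero}  {Fin.suc j} eq = contradiction (sym (cong proj₁ eq)) (cube-nonzero j)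
      fixedPoint-injective {Fin.suc i} {Fin.zero}  eq = contradiction (cong proj₁ eq) (cube-nonzero i)
      fixedPoint-injective {Fin.suc i} {Fin.suc j} eq = cong Fin.suc (cube-injective (cong proj₁ eq))

      fixedPoint-surjective : StrictlySurjective _≡_ fixedPoint
      fixedPoint-surjective (x , gx≡x) with x ≟ 0#
      ... | yes refl = Fin.zero , Σ-≡,≡→≡ (refl , ≡-irrelevant _ _)
      ... | no x≢0   = let j , cube-j≡x = cube-surjective x≢0 (fixed⇒cube x≢0 gx≡x)
                       in Fin.suc j , Σ-≡,≡→≡ (cube-j≡x , ≡-irrelevant _ _)

      fixedPointsCount : FixedPointsCount g (m + 1)
      fixedPointsCount = subst (λ n → Fin n ↔ FixedPoint) (ℕ.+-comm 1 m)
        (⤖⇒↔ (mk⤖ (fixedPoint-injective , strictlySurjective⇒surjective fixedPoint-surjective)))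

      bijective : Bijective _≡_ _≡_ g
      bijective = involutive⇒bijective involutive

trinomial-involution : ∀ {N} m .{{_ : NonZero m}} → N ≡ 3 * m → (F : FiniteField (suc N)) →
  let open FiniteField F in (γ : Carrier) → IsGenerator γ → (k : ℕ) →
  let g = gₖ F γ m k in
  Bijective _≡_ _≡_ g × (∀ x → g (g x) ≡ x) × FixedPointsCount g (m + 1)
trinomial-involution m refl F γ gen k = bijective , involutive , fixedPointsCount
  where open Trinomial F gen k

suc[n]%3≡1⇒n≡3*[n/3] : ∀ {n} → suc n % 3 ≡ 1 → n ≡ 3 * (n / 3)
suc[n]%3≡1⇒n≡3*[n/3] {n} [1+n]%3≡1 = sym (m*[n/m]≡n (divides (suc n / 3)
  (ℕ.suc-injective (trans (m≡m%n+[m/n]*n (suc n) 3) (cong (_+ suc n / 3 * 3) [1+n]%3≡1)))))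

theorem2p1 : (q : ℕ) → Σ ℕ (λ p → Σ ℕ (λ e → Prime p × q ≡ p ^ suc e)) → q % 2 ≡ 1 → q % 3 ≡ 1 →
    (F : FiniteField q) → let open FiniteField F in
    (γ : Carrier) → IsGenerator γ →
    let m = (q ∸ 1) / 3 in
    (k : ℕ) → k < m →
    let aₖ = (γ ^F (2 * m + 6 * k + 2) +F γ ^F (m + 3 * k + 1) +F 1#) /F (3# *F γ ^F (m + 3 * k + 1))
        bₖ = (γ ^F (2 * m) +F γ ^F (m + 3 * k + 1) +F γ ^F (6 * k + 2)) /F (3# *F γ ^F (m + 3 * k + 1))
        cₖ = (γ ^F (6 * k + 2) +F γ ^F (3 * k + 1) +F 1#) /F (3# *F γ ^F (3 * k + 1))
        gₖ = λ x → aₖ *F x ^F (2 * m + 1) +F bₖ *F x ^F (m + 1) +F cₖ *F x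
    in Bijective _≡_ _≡_ gₖ × (∀ x → gₖ (gₖ x) ≡ x) × FixedPointsCount gₖ (m + 1)
theorem2p1 zero _ _ ()
theorem2p1 (suc N) _ _ q%3≡1 F γ gen k k<m =
  trinomial-involution (N / 3) {{>-nonZero (ℕ.≤-<-trans z≤n k<m)}} (suc[n]%3≡1⇒n≡3*[n/3] q%3≡1) F γ gen k
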